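{- Let $G$ be a connected strictly chordal graph, let $S$ be a minimal vertex separator of $G$ with $|B(S)|>1$, write $B(S)=\{Q_1,\dots,Q_b\}$, and let $P_k$ be the set of simplicial vertices of $Q_k$ for $k=1,\dots,b$. Then the Laplacian spectrum of $G$ (as a multiset) contains the following integer eigenvalues: $|Q_k|$ with multiplicity $|P_k|-1$ for each $k=1,\dots,b$, and $|S|$ with multiplicity $b-1$.
   Context: All graphs are finite and simple. The Laplacian matrix of $G$ is $L(G)=D(G)-A(G)$ ($D(G)$ diagonal degree matrix, $A(G)$ adjacency matrix); its eigenvalues are the Laplacian eigenvalues. A block graph is a connected graph in which every block (maximal biconnected subgraph) is a clique. Vertices $u,v$ are true twins if $N[u]=N[v]$, where $N[v]=N(v)\cup\{v\}$. A strictly chordal graph (block duplicate graph) is obtained from a block graph by adding zero or more true twins to its vertices. A vertex is simplicial if its neighborhood is a clique. A simplicial clique is a maximal clique containing a simplicial vertex; a simplicial clique $Q$ is a boundary clique if there is a maximal clique $Q'$ with $Q\cap Q'$ equal to the set of non-simplicial vertices of $Q$. For non-adjacent $u,v$, $S\subset V$ is a $uv$-separator if $u,v$ are in different components of $G-S$, minimal if no proper subset is one; a minimal vertex separator is a minimal $uv$-separator for some non-adjacent pair $u,v$. For a minimal vertex separator $S$, $B(S)$ denotes the set of boundary cliques of $G$ that contain $S$. -}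

module Defs where

open import Data.Nat as ℕ using (ℕ; zero; suc; _∸_; _≡ᵇ_)
open import Data.Bool using (Bool; true; false; if_then_else_)
open import Data.Fin using (Fin; zero; suc; _≟_)
open import Data.Fin.Subset using (Subset; _∈_; _∉_; _⊆_; _⊂_; _-_; ∁; ⊤; ∣_∣; _∪_; ⁅_⁆)
open import Data.Vec using (tabulate)
open import Data.Product using (Σ; _×_; ∃; ∃-syntax; _,_)
open import Function.Bundles using (_⇔_)
open import Function.Definitions using (Injective)
open import Relation.Binary.PropositionalEquality using (_≡_; _≢_)
open import Relation.Nullary using (¬_; yes; no)
open import Data.Rational as ℚ using (ℚ; 0ℚ; _+_; _*_; -_)
open import Data.Integer using (+_)

record Graph (n : ℕ) : Set where
  field
    adj    : Fin n → Fin n → Bool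
    sym    : ∀ i j → adj i j ≡ adj j i
    irrefl : ∀ i → adj i i ≡ false
open Graph public

module _ {n : ℕ} (G : Graph n) where

  Adj : Fin n → Fin n → Set
  Adj u v = adj G u v ≡ true

  data Reach (X : Subset n) : Fin n → Fin n → Set where
    here : ∀ {u} → u ∈ X → Reach X u u
    step : ∀ {u w v} → u ∈ X → Adj u w → Reach X w v → Reach X u v

  ConnectedIn : Subset n → Set
  ConnectedIn X = ∀ u v → u ∈ X → v ∈ X → Reach X u v

  Connected : Set
  Connected = ConnectedIn ⊤

  Biconnected : Subset n → Set
  Biconnected X = (∃[ x ] x ∈ X) × ConnectedIn X × (∀ w → w ∈ X → ConnectedIn (X - w))

  IsBlock : Subset n → Set
  IsBlock X = Biconnected X × (∀ Y → Biconnected Y → X ⊆ Y → Y ⊆ X)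

  IsClique : Subset n → Set
  IsClique X = ∀ u v → u ∈ X → v ∈ X → u ≢ v → Adj u v

  IsMaxClique : Subset n → Set
  IsMaxClique X = IsClique X × (∀ Y → IsClique Y → X ⊆ Y → Y ⊆ X)

  IsBlockGraph : Set
  IsBlockGraph = Connected × (∀ X → IsBlock X → IsClique X)

  Simplicial : Fin n → Set
  Simplicial v = ∀ a b → Adj v a → Adj v b → a ≢ b → Adj a b

  SimplicialClique : Subset n → Set
  SimplicialClique Q = IsMaxClique Q × (∃[ v ] (v ∈ Q × Simplicial v))

  BoundaryClique : Subset n → Set
  BoundaryClique Q = SimplicialClique Q ×
    (∃[ Q' ] (IsMaxClique Q' ×
       (∀ v → ((v ∈ Q × v ∈ Q') ⇔ (v ∈ Q × ¬ Simplicial v)))))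

  IsSeparator : Fin n → Fin n → Subset n → Set
  IsSeparator u v S = u ∉ S × v ∉ S × ¬ Reach (∁ S) u v

  IsMinSeparator : Fin n → Fin n → Subset n → Set
  IsMinSeparator u v S = IsSeparator u v S × (∀ S' → S' ⊂ S → ¬ IsSeparator u v S')

  IsMinimalVertexSeparator : Subset n → Set
  IsMinimalVertexSeparator S =
    ∃[ u ] ∃[ v ] (u ≢ v × adj G u v ≡ false × IsMinSeparator u v S)

  degree : Fin n → ℕ
  degree i = ∣ tabulate (adj G i) ∣

  laplacian : Fin n → Fin n → ℚ
  laplacian i j with i ≟ j
  ... | yes _ = (+ (degree i)) ℚ./ 1
  ... | no _  = if adj G i j then - ℚ.1ℚ else 0ℚ

-- G is obtained from a block graph H by adding true twins:
-- each vertex x of H is replaced by the nonempty clique f⁻¹(x) of true twins.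
IsStrictlyChordal : ∀ {n} → Graph n → Set
IsStrictlyChordal {n} G =
  ∃[ m ] Σ (Graph m) λ H → Σ (Fin n → Fin m) λ f →
    IsBlockGraph H ×
    (∀ x → ∃[ u ] f u ≡ x) ×
    (∀ u v → u ≢ v → (Adj G u v ⇔ ((f u ≡ f v) ⊎' Adj H (f u) (f v))))
  where open import Data.Sum renaming (_⊎_ to _⊎'_)

sumFin : ∀ {m} → (Fin m → ℚ) → ℚ
sumFin {zero}  f = 0ℚ
sumFin {suc m} f = f zero + sumFin (λ i → f (suc i))

mulVec : ∀ {n} → (Fin n → Fin n → ℚ) → (Fin n → ℚ) → (Fin n → ℚ)
mulVec M x i = sumFin (λ j → M i j * x j)

LinIndep : ∀ {n k} → (Fin k → Fin n → ℚ) → Set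
LinIndep {n} {k} xs =
  ∀ (c : Fin k → ℚ) → (∀ i → sumFin (λ t → c t * xs t i) ≡ 0ℚ) → ∀ t → c t ≡ 0ℚ

-- λ is an eigenvalue of M with multiplicity at least k (M symmetric, so
-- algebraic multiplicity = dimension of the eigenspace)
EigenMultAtLeast : ∀ {n} → (Fin n → Fin n → ℚ) → ℚ → ℕ → Set
EigenMultAtLeast {n} M λ' k =
  Σ (Fin k → Fin n → ℚ) λ xs →
    LinIndep xs × (∀ t i → mulVec M (xs t) i ≡ λ' * xs t i)

ifEq : ℕ → ℕ → ℕ → ℕ
ifEq a b x = if a ≡ᵇ b then x else 0

sumFinℕ : ∀ {m} → (Fin m → ℕ) → ℕ
sumFinℕ {zero}  f = 0
sumFinℕ {suc m} f = f zero ℕ.+ sumFinℕ (λ i → f (suc i))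

-- Every boundary clique Q_k ⊇ S is the disjoint union of S and the set P_k of its simplicial
-- vertices. Indeed, the non-simplicial vertices of Q_k, S among them, all lie in a second
-- maximal clique Q′; in a strictly chordal graph two distinct maximal cliques meet in true
-- twins, so a non-simplicial v ∉ S would be a twin of any s ∈ S, and S - s would still
-- separate, against minimality.
--
-- If x is supported on simplicial vertices of a maximal clique Q, then
-- L x = |Q| x - (Σ x) 𝟙_Q. Hence e_p - e_q (p, q ∈ P_k) is an eigenvector for |Q_k|, and since
-- 𝟙_{Q_k} = 𝟙_S + 𝟙_{P_k}, so is |P_k| 𝟙_{P_0} - |P_0| 𝟙_{P_k} (k ≥ 1) for |S|. In each of these
-- families every vector is the only one that is nonzero at a chosen pivot vertex, which gives
-- linear independence; the families for |Q_k| live on the disjoint sets P_k, and |S| < |Q_k|,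
-- so the two kinds of eigenvalues never have to be counted together.

module Submission where

open import Defs hiding (sym)
open import Data.Bool as Bool using (Bool; true; false; if_then_else_)
open import Data.Empty using (⊥; ⊥-elim)
open import Data.Fin using (Fin; zero; suc; _≟_)
open import Data.Fin.Properties using (suc-injective; 0≢1+n)
open import Data.Fin.Subset as Subset using (Subset; _∈_; _∉_; _⊆_; ∁; ∣_∣; _∪_; ⁅_⁆; Nonempty)
open import Data.Fin.Subset.Properties
  using (_∈?_; nonempty?; ∈⊤; x∈⁅x⁆; x∈⁅y⁆⇒x≡y; x∈p∪q⁺; x∈p∪q⁻; p⊆p∪q; ⊆-refl; ⊆-antisym;
         p─q⊆p; x∈p∧x≢y⇒x∈p-y; x∈p⇒p-x⊂p; x∈∁p⇒x∉p; x∉p⇒x∈∁p; ∣p∣≤n; p⊂q⇒∣p∣<∣q∣)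
open import Data.Nat as ℕ using (ℕ; zero; suc; _<_; _∸_)
import Data.Nat.Properties as ℕ
open import Data.Product using (_×_; _,_; proj₁; proj₂; ∃-syntax)
open import Data.Sum using (_⊎_; inj₁; inj₂)
open import Function using (_∘_)
open import Function.Bundles using (_⇔_; mk⇔; Equivalence)
open import Relation.Binary.PropositionalEquality
  using (_≡_; _≢_; refl; sym; trans; cong; subst; subst₂)
open import Relation.Nullary using (¬_; yes; no; Dec)

module _ {n : ℕ} (G : Graph n) where

  Adj? : ∀ u v → Dec (Adj G u v)
  Adj? u v = adj G u v Bool.≟ true

  Adj-sym : ∀ {u v} → Adj G u v → Adj G v u
  Adj-sym {u} {v} = trans (Graph.sym G v u)

  Adj⇒≢ : ∀ {u v} → Adj G u v → u ≢ v
  Adj⇒≢ {u} uu refl with trans (sym (irrefl G u)) uu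
  ... | ()

  Reach-head : ∀ {X u v} → Reach G X u v → u ∈ X
  Reach-head (here u∈X)     = u∈X
  Reach-head (step u∈X _ _) = u∈X

  Reach-++ : ∀ {X u v w} → Reach G X u v → Reach G X v w → Reach G X u w
  Reach-++ (here _)           walk  = walk
  Reach-++ (step u∈X uv walk) walk′ = step u∈X uv (Reach-++ walk walk′)

  Reach-mono : ∀ {X Y u v} → X ⊆ Y → Reach G X u v → Reach G Y u v
  Reach-mono X⊆Y (here u∈X)         = here (X⊆Y u∈X)
  Reach-mono X⊆Y (step u∈X uw walk) = step (X⊆Y u∈X) uw (Reach-mono X⊆Y walk)

  Reach-map : ∀ {X Y} (g : Fin n → Fin n) → (∀ {u} → u ∈ X → g u ∈ Y) →
    (∀ {u w} → u ∈ X → w ∈ X → Adj G u w → g u ≡ g w ⊎ Adj G (g u) (g w)) →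
    ∀ {u v} → Reach G X u v → Reach G Y (g u) (g v)
  Reach-map g g∈ g-adj (here u∈X) = here (g∈ u∈X)
  Reach-map {Y = Y} g g∈ g-adj {v = v} (step u∈X uw walk) with g-adj u∈X (Reach-head walk) uw
  ... | inj₁ gu≡gw = subst (λ z → Reach G Y z (g v)) (sym gu≡gw) (Reach-map g g∈ g-adj walk)
  ... | inj₂ gu-gw = step (g∈ u∈X) gu-gw (Reach-map g g∈ g-adj walk)

  hub⇒connected : ∀ {Y h} → h ∈ Y → (∀ {u} → u ∈ Y → u ≡ h ⊎ Adj G u h) → ConnectedIn G Y
  hub⇒connected {Y} {h} h∈Y hub u v u∈Y v∈Y = Reach-++ (toHub u∈Y) (fromHub v∈Y)
    where
    toHub : ∀ {u} → u ∈ Y → Reach G Y u h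
    toHub u∈Y with hub u∈Y
    ... | inj₁ refl = here h∈Y
    ... | inj₂ uh   = step u∈Y uh (here h∈Y)
    fromHub : ∀ {v} → v ∈ Y → Reach G Y h v
    fromHub v∈Y with hub v∈Y
    ... | inj₁ refl = here h∈Y
    ... | inj₂ vh   = step h∈Y (Adj-sym vh) (here v∈Y)

  twoHubs⇒biconnected : ∀ {Y c d} → c ∈ Y → d ∈ Y → Adj G c d →
    (∀ {u} → u ∈ Y → (u ≡ c ⊎ Adj G u c) × (u ≡ d ⊎ Adj G u d)) → Biconnected G Y
  twoHubs⇒biconnected {Y} {c} {d} c∈Y d∈Y cd hubs =
    (c , c∈Y) , hub⇒connected c∈Y (proj₁ ∘ hubs) , connectedWithout
    where
    connectedWithout : ∀ w → w ∈ Y → ConnectedIn G (Y Subset.- w)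
    connectedWithout w _ with w ≟ c
    ... | yes refl = hub⇒connected (x∈p∧x≢y⇒x∈p-y d∈Y (Adj⇒≢ cd ∘ sym))
                                   (λ u∈ → proj₂ (hubs (p─q⊆p Y ⁅ w ⁆ u∈)))
    ... | no  w≢c  = hub⇒connected (x∈p∧x≢y⇒x∈p-y c∈Y (w≢c ∘ sym))
                                   (λ u∈ → proj₁ (hubs (p─q⊆p Y ⁅ w ⁆ u∈)))

  -- Only ¬¬: being a maximal biconnected set is not decidable. The fuel k bounds how often X
  -- can still be enlarged.
  biconnected⊆block : ∀ X → Biconnected G X → ¬ ¬ (∃[ Y ] IsBlock G Y × X ⊆ Y)
  biconnected⊆block X X-bic = grow (suc n) X (ℕ.m≤m+n (suc n) ∣ X ∣) X-bic
    where
    grow : ∀ k X → n < k ℕ.+ ∣ X ∣ → Biconnected G X → ¬ ¬ (∃[ Y ] IsBlock G Y × X ⊆ Y)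
    grow zero    X n<∣X∣ _     _       = ℕ.<⇒≱ n<∣X∣ (∣p∣≤n X)
    grow (suc k) X bound X-bic noBlock = noBlock (X , (X-bic , maximal) , ⊆-refl)
      where
      maximal : ∀ Y → Biconnected G Y → X ⊆ Y → Y ⊆ X
      maximal Y Y-bic X⊆Y {i} i∈Y with i ∈? X
      ... | yes i∈X = i∈X
      ... | no  i∉X = ⊥-elim (grow k Y bound′ Y-bic
                        λ (Z , Z-block , Y⊆Z) → noBlock (Z , Z-block , Y⊆Z ∘ X⊆Y))
        where
        bound′ : n < k ℕ.+ ∣ Y ∣
        bound′ = ℕ.≤-trans bound (ℕ.≤-trans (ℕ.≤-reflexive (sym (ℕ.+-suc k ∣ X ∣)))
                   (ℕ.+-monoʳ-≤ k (p⊂q⇒∣p∣<∣q∣ (X⊆Y , i , i∈Y , i∉X))))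

  maxClique-absorbs : ∀ {R a} → IsMaxClique G R → (∀ e → e ∈ R → e ≢ a → Adj G a e) → a ∈ R
  maxClique-absorbs {R} {a} (R-clique , R-max) a-adj =
    R-max (R ∪ ⁅ a ⁆) extended (p⊆p∪q ⁅ a ⁆) (x∈p∪q⁺ (inj₂ (x∈⁅x⁆ a)))
    where
    extended : IsClique G (R ∪ ⁅ a ⁆)
    extended u v u∈ v∈ u≢v with x∈p∪q⁻ R ⁅ a ⁆ u∈ | x∈p∪q⁻ R ⁅ a ⁆ v∈
    ... | inj₁ u∈R | inj₁ v∈R = R-clique u v u∈R v∈R u≢v
    ... | inj₁ u∈R | inj₂ v∈a with refl ← x∈⁅y⁆⇒x≡y a v∈a = Adj-sym (a-adj u u∈R u≢v)
    ... | inj₂ u∈a | inj₁ v∈R with refl ← x∈⁅y⁆⇒x≡y a u∈a = a-adj v v∈R (u≢v ∘ sym)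
    ... | inj₂ u∈a | inj₂ v∈a = ⊥-elim (u≢v (trans (x∈⁅y⁆⇒x≡y a u∈a) (sym (x∈⁅y⁆⇒x≡y a v∈a))))

  maxCliques-≢⇒¬⊆ : ∀ {Q R} → IsMaxClique G Q → IsMaxClique G R → Q ≢ R →
    ¬ ¬ (∃[ a ] a ∈ Q × a ∉ R)
  maxCliques-≢⇒¬⊆ {Q} {R} (_ , Q-max) (R-clique , _) Q≢R noWitness =
    Q≢R (⊆-antisym Q⊆R (Q-max R R-clique Q⊆R))
    where
    Q⊆R : Q ⊆ R
    Q⊆R {a} a∈Q with a ∈? R
    ... | yes a∈R = a∈R
    ... | no  a∉R = ⊥-elim (noWitness (a , a∈Q , a∉R))

  ∉maxClique⇒nonneighbour : ∀ {R a} → IsMaxClique G R → a ∉ R → ¬ ¬ (∃[ e ] e ∈ R × ¬ Adj G a e)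
  ∉maxClique⇒nonneighbour {R} {a} R-max a∉R noWitness = a∉R (maxClique-absorbs R-max neighbour)
    where
    neighbour : ∀ e → e ∈ R → e ≢ a → Adj G a e
    neighbour e e∈R _ with Adj? a e
    ... | yes ae  = ae
    ... | no  ¬ae = ⊥-elim (noWitness (e , e∈R , ¬ae))

  simplicial-neighbour∈ : ∀ {Q p v} → IsMaxClique G Q → p ∈ Q → Simplicial G p → Adj G p v → v ∈ Q
  simplicial-neighbour∈ {Q} {p} {v} Q-max p∈Q p-simp pv = maxClique-absorbs Q-max v-adj
    where
    v-adj : ∀ e → e ∈ Q → e ≢ v → Adj G v e
    v-adj e e∈Q e≢v with e ≟ p
    ... | yes refl = Adj-sym pv
    ... | no  e≢p  = p-simp v e pv (proj₁ Q-max p e p∈Q e∈Q (e≢p ∘ sym)) (e≢v ∘ sym)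

  simplicial-adj⇔∈ : ∀ {Q p j} → IsMaxClique G Q → p ∈ Q → Simplicial G p → j ≢ p →
    Adj G p j ⇔ j ∈ Q
  simplicial-adj⇔∈ Q-max p∈Q p-simp j≢p =
    mk⇔ (simplicial-neighbour∈ Q-max p∈Q p-simp) (λ j∈Q → proj₁ Q-max _ _ p∈Q j∈Q (j≢p ∘ sym))

  simplicial-unique-maxClique : ∀ {Q R p} → IsMaxClique G Q → IsMaxClique G R →
    p ∈ Q → p ∈ R → Simplicial G p → Q ≡ R
  simplicial-unique-maxClique {p = p} Q-max R-max p∈Q p∈R p-simp =
    ⊆-antisym (included Q-max R-max p∈Q p∈R) (included R-max Q-max p∈R p∈Q)
    where
    included : ∀ {X Y} → IsMaxClique G X → IsMaxClique G Y → p ∈ X → p ∈ Y → X ⊆ Y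
    included X-max Y-max p∈X p∈Y {v} v∈X with v ≟ p
    ... | yes refl = p∈Y
    ... | no  v≢p  = simplicial-neighbour∈ Y-max p∈Y p-simp (proj₁ X-max p v p∈X v∈X (v≢p ∘ sym))

  maxCliques-∩⇒nonsimplicial : ∀ {Q R v} → IsMaxClique G Q → IsMaxClique G R → Q ≢ R →
    v ∈ Q → v ∈ R → ¬ Simplicial G v
  maxCliques-∩⇒nonsimplicial Q-max R-max Q≢R v∈Q v∈R v-simp =
    Q≢R (simplicial-unique-maxClique Q-max R-max v∈Q v∈R v-simp)

  separator-nonempty : ∀ {x y S} → Connected G → IsSeparator G x y S → Nonempty S
  separator-nonempty {x} {y} {S} connected (_ , _ , x↛y) with nonempty? S
  ... | yes S≠∅ = S≠∅
  ... | no  S=∅ = ⊥-elim (x↛y (Reach-mono outside (connected x y ∈⊤ ∈⊤)))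
    where
    outside : ∀ {z} → z ∈ Subset.⊤ → z ∈ ∁ S
    outside {z} _ = x∉p⇒x∈∁p (λ z∈S → S=∅ (z , z∈S))

  minimalSeparator-undominated : ∀ {x y S s v} → IsMinSeparator G x y S → s ∈ S → v ∉ S →
    ¬ (∀ w → w ≢ v → Adj G s w → Adj G v w)
  minimalSeparator-undominated {x} {y} {S} {s} {v} ((x∉S , y∉S , x↛y) , minimal) s∈S v∉S dominated =
    minimal (S Subset.- s) (x∈p⇒p-x⊂p s∈S)
      (x∉S ∘ p─q⊆p S ⁅ s ⁆ , y∉S ∘ p─q⊆p S ⁅ s ⁆ , x↛y ∘ reroute)
    where
    -- Walks avoiding S - s are rerouted through v instead of s.
    g : Fin n → Fin n
    g u with u ≟ s
    ... | yes _ = v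
    ... | no  _ = u

    g-fixes : ∀ {u} → u ∉ S → g u ≡ u
    g-fixes {u} u∉S with u ≟ s
    ... | yes refl = ⊥-elim (u∉S s∈S)
    ... | no  _    = refl

    g∈ : ∀ {u} → u ∈ ∁ (S Subset.- s) → g u ∈ ∁ S
    g∈ {u} u∈ with u ≟ s
    ... | yes _   = x∉p⇒x∈∁p v∉S
    ... | no  u≢s = x∉p⇒x∈∁p (λ u∈S → x∈∁p⇒x∉p u∈ (x∈p∧x≢y⇒x∈p-y u∈S u≢s))

    g-adj : ∀ {u w} → u ∈ ∁ (S Subset.- s) → w ∈ ∁ (S Subset.- s) → Adj G u w →
            g u ≡ g w ⊎ Adj G (g u) (g w)
    g-adj {u} {w} _ _ uw with u ≟ s | w ≟ s
    ... | yes refl | yes refl = inj₁ refl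
    ... | yes refl | no  _ with v ≟ w
    ...   | yes v≡w = inj₁ v≡w
    ...   | no  v≢w = inj₂ (dominated w (v≢w ∘ sym) uw)
    g-adj {u} _ _ uw | no _ | yes refl with u ≟ v
    ...   | yes u≡v = inj₁ u≡v
    ...   | no  u≢v = inj₂ (Adj-sym (dominated u u≢v (Adj-sym uw)))
    g-adj _ _ uw | no _ | no _ = inj₂ uw

    reroute : Reach G (∁ (S Subset.- s)) x y → Reach G (∁ S) x y
    reroute walk = subst₂ (Reach G (∁ S)) (g-fixes x∉S) (g-fixes y∉S) (Reach-map g g∈ g-adj walk)

module _ {m : ℕ} {H : Graph m} (blockGraph : IsBlockGraph H) where

  blockGraph-diamond : ∀ {a c d e} → Adj H c d → Adj H a c → Adj H a d → Adj H e c → Adj H e d →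
    a ≢ e → Adj H a e
  blockGraph-diamond {a} {c} {d} {e} cd ac ad ec ed a≢e with Adj? H a e
  ... | yes ae  = ae
  ... | no  ¬ae = ⊥-elim (biconnected⊆block H D (twoHubs⇒biconnected H c∈D d∈D cd hubs)
                    λ (Y , Y-block , D⊆Y) →
                      ¬ae (proj₂ blockGraph Y Y-block a e (D⊆Y a∈D) (D⊆Y e∈D) a≢e))
    where
    D : Subset m
    D = ⁅ c ⁆ ∪ ⁅ d ⁆ ∪ ⁅ a ⁆ ∪ ⁅ e ⁆
    c∈D : c ∈ D
    c∈D = x∈p∪q⁺ (inj₁ (x∈⁅x⁆ c))
    d∈D : d ∈ D
    d∈D = x∈p∪q⁺ (inj₂ (x∈p∪q⁺ (inj₁ (x∈⁅x⁆ d))))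
    a∈D : a ∈ D
    a∈D = x∈p∪q⁺ (inj₂ (x∈p∪q⁺ (inj₂ (x∈p∪q⁺ (inj₁ (x∈⁅x⁆ a))))))
    e∈D : e ∈ D
    e∈D = x∈p∪q⁺ (inj₂ (x∈p∪q⁺ (inj₂ (x∈p∪q⁺ (inj₂ (x∈⁅x⁆ e))))))
    hubs : ∀ {u} → u ∈ D → (u ≡ c ⊎ Adj H u c) × (u ≡ d ⊎ Adj H u d)
    hubs u∈D with x∈p∪q⁻ ⁅ c ⁆ _ u∈D
    ... | inj₁ u∈c with refl ← x∈⁅y⁆⇒x≡y c u∈c = inj₁ refl , inj₂ cd
    ... | inj₂ u∈D′ with x∈p∪q⁻ ⁅ d ⁆ _ u∈D′
    ...   | inj₁ u∈d with refl ← x∈⁅y⁆⇒x≡y d u∈d = inj₂ (Adj-sym H cd) , inj₁ refl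
    ...   | inj₂ u∈D″ with x∈p∪q⁻ ⁅ a ⁆ _ u∈D″
    ...     | inj₁ u∈a with refl ← x∈⁅y⁆⇒x≡y a u∈a = inj₂ ac , inj₂ ad
    ...     | inj₂ u∈e with refl ← x∈⁅y⁆⇒x≡y e u∈e = inj₂ ec , inj₂ ed

TwinExpansion : ∀ {n m} → Graph n → Graph m → (Fin n → Fin m) → Set
TwinExpansion G H f = ∀ u v → u ≢ v → (Adj G u v ⇔ (f u ≡ f v ⊎ Adj H (f u) (f v)))

record SimplicialSplit {n} (G : Graph n) (S Q P : Subset n) : Set where
  field
    maxClique  : IsMaxClique G Q
    S⊆Q        : S ⊆ Q
    simplicial : ∀ v → v ∈ P ⇔ (v ∈ Q × Simplicial G v)
    Q∖P⊆S      : ∀ {v} → v ∈ Q → v ∉ P → v ∈ S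
    P-nonempty : Nonempty P

  P⊆Q : P ⊆ Q
  P⊆Q v∈P = proj₁ (Equivalence.to (simplicial _) v∈P)

  P-simplicial : ∀ {v} → v ∈ P → Simplicial G v
  P-simplicial v∈P = proj₂ (Equivalence.to (simplicial _) v∈P)

module _ {n m} {G : Graph n} {H : Graph m} {f : Fin n → Fin m}
         (blockGraph : IsBlockGraph H) (expansion : TwinExpansion G H f) where

  twin-adj : ∀ {x y z} → f x ≡ f y → x ≢ z → y ≢ z → Adj G y z → Adj G x z
  twin-adj {x} {y} {z} fx≡fy x≢z y≢z yz = Equivalence.from (expansion x z x≢z)
    (subst (λ q → q ≡ f z ⊎ Adj H q (f z)) (sym fx≡fy) (Equivalence.to (expansion y z y≢z) yz))

  adj-image : ∀ {x y} → Adj G x y → f x ≢ f y → Adj H (f x) (f y)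
  adj-image {x} {y} xy fx≢fy with Equivalence.to (expansion x y (Adj⇒≢ G xy)) xy
  ... | inj₁ fx≡fy = ⊥-elim (fx≢fy fx≡fy)
  ... | inj₂ fx-fy = fx-fy

  -- If f u ≠ f w, take a ∈ Q ∖ R and a non-neighbour e ∈ R of a: f a and f e are both adjacent
  -- to the adjacent vertices f u and f w of the block graph H, which forces f a ~ f e, so a ~ e.
  maxCliques-∩⇒twins : ∀ {Q R u w} → IsMaxClique G Q → IsMaxClique G R → Q ≢ R →
    u ∈ Q → u ∈ R → w ∈ Q → w ∈ R → f u ≡ f w
  maxCliques-∩⇒twins {Q} {R} {u} {w} Q-max R-max Q≢R u∈Q u∈R w∈Q w∈R with f u ≟ f w
  ... | yes fu≡fw = fu≡fw
  ... | no  fu≢fw = ⊥-elim (maxCliques-≢⇒¬⊆ G Q-max R-max Q≢R λ (a , a∈Q , a∉R) →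
                      ∉maxClique⇒nonneighbour G R-max a∉R λ (e , e∈R , ¬ae) →
                        ¬ae (adjacent-across a∈Q a∉R e∈R ¬ae))
    where
    adjacent-across : ∀ {a e} → a ∈ Q → a ∉ R → e ∈ R → ¬ Adj G a e → Adj G a e
    adjacent-across {a} {e} a∈Q a∉R e∈R ¬ae = Equivalence.from (expansion a e a≢e)
      (inj₂ (blockGraph-diamond blockGraph (adj-image (proj₁ Q-max u w u∈Q w∈Q u≢w) fu≢fw)
              (proj₁ (images u∈Q u∈R)) (proj₁ (images w∈Q w∈R))
              (proj₂ (images u∈Q u∈R)) (proj₂ (images w∈Q w∈R))
              (¬ae ∘ Equivalence.from (expansion a e a≢e) ∘ inj₁)))
      where
      a≢e : a ≢ e
      a≢e refl = a∉R e∈R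
      u≢w : u ≢ w
      u≢w refl = fu≢fw refl
      images : ∀ {z} → z ∈ Q → z ∈ R → Adj H (f a) (f z) × Adj H (f e) (f z)
      images {z} z∈Q z∈R =
          adj-image az (λ fa≡fz → ¬ae (twin-adj fa≡fz a≢e z≢e ze))
        , adj-image (Adj-sym G ze)
            (λ fe≡fz → ¬ae (Adj-sym G (twin-adj fe≡fz (a≢e ∘ sym) (a≢z ∘ sym) (Adj-sym G az))))
        where
        a≢z : a ≢ z
        a≢z refl = a∉R z∈R
        az : Adj G a z
        az = proj₁ Q-max a z a∈Q z∈Q a≢z
        z≢e : z ≢ e
        z≢e refl = ¬ae az
        ze : Adj G z e
        ze = proj₁ R-max z e z∈R e∈R z≢e

  boundaryClique-split : ∀ {x y S Q P} → Connected G → IsMinSeparator G x y S →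
    (∀ {s} → s ∈ S → ¬ Simplicial G s) → BoundaryClique G Q → S ⊆ Q →
    (∀ v → v ∈ P ⇔ (v ∈ Q × Simplicial G v)) → SimplicialSplit G S Q P
  boundaryClique-split {S = S} {Q} {P} connected minSep S-nonsimplicial
    ((Q-max , p , p∈Q , p-simp) , Q′ , Q′-max , Q∩Q′) S⊆Q P⇔ = record
      { maxClique  = Q-max
      ; S⊆Q        = S⊆Q
      ; simplicial = P⇔
      ; Q∖P⊆S      = nonsimplicial∈S
      ; P-nonempty = p , Equivalence.from (P⇔ p) (p∈Q , p-simp)
      }
    where
    ∈Q′ : ∀ {v} → v ∈ Q → ¬ Simplicial G v → v ∈ Q′
    ∈Q′ v∈Q v-nonsimp = proj₂ (Equivalence.from (Q∩Q′ _) (v∈Q , v-nonsimp))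

    Q≢Q′ : Q ≢ Q′
    Q≢Q′ refl = proj₂ (Equivalence.to (Q∩Q′ p) (p∈Q , p∈Q)) p-simp

    nonsimplicial∈S : ∀ {v} → v ∈ Q → v ∉ P → v ∈ S
    nonsimplicial∈S {v} v∈Q v∉P with v ∈? S | separator-nonempty G connected (proj₁ minSep)
    ... | yes v∈S | _ = v∈S
    ... | no  v∉S | s , s∈S = ⊥-elim (minimalSeparator-undominated G minSep s∈S v∉S dominated)
      where
      v-nonsimp : ¬ Simplicial G v
      v-nonsimp v-simp = v∉P (Equivalence.from (P⇔ v) (v∈Q , v-simp))
      fv≡fs : f v ≡ f s
      fv≡fs = maxCliques-∩⇒twins Q-max Q′-max Q≢Q′ v∈Q (∈Q′ v∈Q v-nonsimp)
                (S⊆Q s∈S) (∈Q′ (S⊆Q s∈S) (S-nonsimplicial s∈S))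
      dominated : ∀ w → w ≢ v → Adj G s w → Adj G v w
      dominated w w≢v sw = twin-adj fv≡fs (w≢v ∘ sym) (Adj⇒≢ G sw) sw

module LaplacianEigenvectors where

  open import Data.Bool.Properties using (T-≡; ¬-not)
  open import Data.Fin using (splitAt; join)
  open import Data.Fin.Properties using (join-splitAt)
  import Data.Integer as ℤ
  import Data.Integer.Properties as ℤ
  import Data.Nat.Coprimality as Coprime
  open import Data.Rational using (ℚ; mkℚ; 0ℚ; 1ℚ; _/_; _+_; _*_; _-_; -_; 1/_; NonZero; ≢-nonZero)
  import Data.Rational.Properties as ℚ
  open import Data.Sum using ([_,_])
  open import Data.Unit using (⊤; tt)
  open import Data.Vec using ([]; _∷_; lookup; tabulate; here; there)
  open import Data.Vec.Properties using ([]=⇒lookup; lookup⇒[]=; []=↔lookup; lookup∘tabulate)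
  open import Function.Properties.Equivalence using () renaming (trans to ⇔-trans)
  open import Function.Properties.Inverse using (↔⇒⇔)
  open import Function.Definitions using (Injective)
  open import Level using (0ℓ)
  open import Relation.Binary.PropositionalEquality using (cong₂; module ≡-Reasoning)
  open import Relation.Nullary.Decidable using (⌊_⌋; dec⇒maybe)
  open import Tactic.RingSolver using (solve-∀)
  open import Tactic.RingSolver.Core.AlmostCommutativeRing
    using (AlmostCommutativeRing; fromCommutativeRing)
  open ≡-Reasoning

  ℚ-ring : AlmostCommutativeRing 0ℓ 0ℓ
  ℚ-ring = fromCommutativeRing ℚ.+-*-commutativeRing (λ x → dec⇒maybe (0ℚ ℚ.≟ x))

  fromℕ : ℕ → ℚ
  fromℕ n = ℤ.+ n / 1

  fromℕ≡mkℚ : ∀ n → fromℕ n ≡ mkℚ (ℤ.+ n) 0 (Coprime.sym (Coprime.1-coprimeTo n))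
  fromℕ≡mkℚ n = ℚ.normalize-coprime _

  fromℕ-+ : ∀ m n → fromℕ (m ℕ.+ n) ≡ fromℕ m + fromℕ n
  fromℕ-+ m n rewrite fromℕ≡mkℚ m | fromℕ≡mkℚ n =
    cong (_/ 1) (sym (cong₂ ℤ._+_ (ℤ.*-identityʳ (ℤ.+ m)) (ℤ.*-identityʳ (ℤ.+ n))))

  fromℕ-suc≢0 : ∀ n → fromℕ (suc n) ≢ 0ℚ
  fromℕ-suc≢0 n eq with trans (sym (fromℕ≡mkℚ (suc n))) eq
  ... | ()

  x*y≡0⇒x≡0 : ∀ {x y} → y ≢ 0ℚ → x * y ≡ 0ℚ → x ≡ 0ℚ
  x*y≡0⇒x≡0 {x} {y} y≢0 xy≡0 = begin
    x              ≡⟨ cancel ⟨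
    x * y * 1/ y   ≡⟨ cong (_* 1/ y) xy≡0 ⟩
    0ℚ * 1/ y      ≡⟨ ℚ.*-zeroˡ (1/ y) ⟩
    0ℚ             ∎
    where
    instance
      y-nonZero : NonZero y
      y-nonZero = ≢-nonZero y≢0
    cancel : x * y * 1/ y ≡ x
    cancel = trans (ℚ.*-assoc x y (1/ y)) (trans (cong (x *_) (ℚ.*-inverseʳ y)) (ℚ.*-identityʳ x))

  𝟙 : Bool → ℚ
  𝟙 true  = 1ℚ
  𝟙 false = 0ℚ

  𝟙-∈ : ∀ {n} {p : Subset n} {j} → j ∈ p → 𝟙 (lookup p j) ≡ 1ℚ
  𝟙-∈ j∈p = cong 𝟙 ([]=⇒lookup j∈p)

  𝟙-∉ : ∀ {n} {p : Subset n} {j} → j ∉ p → 𝟙 (lookup p j) ≡ 0ℚ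
  𝟙-∉ {p = p} {j} j∉p = cong 𝟙 (¬-not (j∉p ∘ lookup⇒[]= j p))

  𝟙≢0⇒∈ : ∀ {n} {p : Subset n} {j} → 𝟙 (lookup p j) ≢ 0ℚ → j ∈ p
  𝟙≢0⇒∈ {p = p} {j} 𝟙≢0 with lookup p j in p[j]
  ... | true  = lookup⇒[]= j p p[j]
  ... | false = ⊥-elim (𝟙≢0 refl)

  true⇔true⇒≡ : ∀ {a b : Bool} → (a ≡ true) ⇔ (b ≡ true) → a ≡ b
  true⇔true⇒≡ {true}  {true}  _   = refl
  true⇔true⇒≡ {false} {false} _   = refl
  true⇔true⇒≡ {true}  {false} a⇔b = sym (Equivalence.to a⇔b refl)
  true⇔true⇒≡ {false} {true}  a⇔b = Equivalence.from a⇔b refl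

  δ : ∀ {n} → Fin n → Fin n → ℚ
  δ i j = 𝟙 ⌊ i ≟ j ⌋

  δ-refl : ∀ {n} (i : Fin n) → δ i i ≡ 1ℚ
  δ-refl i with i ≟ i
  ... | yes _   = refl
  ... | no  i≢i = ⊥-elim (i≢i refl)

  δ-≢ : ∀ {n} {i j : Fin n} → i ≢ j → δ i j ≡ 0ℚ
  δ-≢ {i = i} {j} i≢j with i ≟ j
  ... | yes i≡j = ⊥-elim (i≢j i≡j)
  ... | no  _   = refl

  sumFin-cong : ∀ {m} {f g : Fin m → ℚ} → (∀ i → f i ≡ g i) → sumFin f ≡ sumFin g
  sumFin-cong {zero}  _   = refl
  sumFin-cong {suc m} f≗g = cong₂ _+_ (f≗g zero) (sumFin-cong (f≗g ∘ suc))

  sumFin-zero : ∀ {m} (f : Fin m → ℚ) → (∀ i → f i ≡ 0ℚ) → sumFin f ≡ 0ℚ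
  sumFin-zero {zero}  _ _   = refl
  sumFin-zero {suc m} f f≗0 = cong₂ _+_ (f≗0 zero) (sumFin-zero (f ∘ suc) (f≗0 ∘ suc))

  sumFin-single : ∀ {m} (f : Fin m → ℚ) i → (∀ j → j ≢ i → f j ≡ 0ℚ) → sumFin f ≡ f i
  sumFin-single {suc m} f zero others =
    trans (cong (f zero +_) (sumFin-zero (f ∘ suc) (λ j → others (suc j) (λ ()))))
          (ℚ.+-identityʳ (f zero))
  sumFin-single {suc m} f (suc i) others =
    trans (cong (_+ sumFin (f ∘ suc)) (others zero (λ ())))
          (trans (ℚ.+-identityˡ _)
                 (sumFin-single (f ∘ suc) i (λ j j≢i → others (suc j) (j≢i ∘ suc-injective))))

  sumFin-+ : ∀ {m} (f g : Fin m → ℚ) → sumFin (λ i → f i + g i) ≡ sumFin f + sumFin g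
  sumFin-+ {zero}  _ _ = refl
  sumFin-+ {suc m} f g =
    trans (cong (f zero + g zero +_) (sumFin-+ (f ∘ suc) (g ∘ suc)))
          (interchange (f zero) (g zero) (sumFin (f ∘ suc)) (sumFin (g ∘ suc)))
    where
    interchange : ∀ a b c d → a + b + (c + d) ≡ a + c + (b + d)
    interchange = solve-∀ ℚ-ring

  sumFin-sub : ∀ {m} (f g : Fin m → ℚ) → sumFin (λ i → f i - g i) ≡ sumFin f - sumFin g
  sumFin-sub {zero}  _ _ = refl
  sumFin-sub {suc m} f g =
    trans (cong (f zero - g zero +_) (sumFin-sub (f ∘ suc) (g ∘ suc)))
          (interchange (f zero) (g zero) (sumFin (f ∘ suc)) (sumFin (g ∘ suc)))
    where
    interchange : ∀ a b c d → a - b + (c - d) ≡ a + c - (b + d)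
    interchange = solve-∀ ℚ-ring

  sumFin-*ˡ : ∀ {m} c (f : Fin m → ℚ) → sumFin (λ i → c * f i) ≡ c * sumFin f
  sumFin-*ˡ {zero}  c _ = sym (ℚ.*-zeroʳ c)
  sumFin-*ˡ {suc m} c f =
    trans (cong (c * f zero +_) (sumFin-*ˡ c (f ∘ suc))) (sym (ℚ.*-distribˡ-+ c (f zero) _))

  sumFin-*ʳ : ∀ {m} c (f : Fin m → ℚ) → sumFin (λ i → f i * c) ≡ sumFin f * c
  sumFin-*ʳ c f = trans (sumFin-cong (λ i → ℚ.*-comm (f i) c))
                        (trans (sumFin-*ˡ c f) (ℚ.*-comm c (sumFin f)))

  sumFin-δ : ∀ {m} (i : Fin m) (f : Fin m → ℚ) → sumFin (λ j → δ i j * f j) ≡ f i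
  sumFin-δ i f = trans (sumFin-single (λ j → δ i j * f j) i off-diagonal) on-diagonal
    where
    off-diagonal : ∀ j → j ≢ i → δ i j * f j ≡ 0ℚ
    off-diagonal j j≢i = trans (cong (_* f j) (δ-≢ (j≢i ∘ sym))) (ℚ.*-zeroˡ (f j))
    on-diagonal : δ i i * f i ≡ f i
    on-diagonal = trans (cong (_* f i) (δ-refl i)) (ℚ.*-identityˡ (f i))

  sumFin-δ₁ : ∀ {m} (i : Fin m) → sumFin (δ i) ≡ 1ℚ
  sumFin-δ₁ i = trans (sumFin-cong (λ j → sym (ℚ.*-identityʳ (δ i j)))) (sumFin-δ i (λ _ → 1ℚ))

  sumFin-𝟙 : ∀ {m} (p : Subset m) → fromℕ ∣ p ∣ ≡ sumFin (λ j → 𝟙 (lookup p j))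
  sumFin-𝟙 []          = refl
  sumFin-𝟙 (true ∷ p)  = trans (fromℕ-+ 1 ∣ p ∣) (cong (1ℚ +_) (sumFin-𝟙 p))
  sumFin-𝟙 (false ∷ p) = trans (sumFin-𝟙 p) (sym (ℚ.+-identityˡ _))

  fromℕ∣∣≢0 : ∀ {m} (p : Subset m) → Nonempty p → fromℕ ∣ p ∣ ≢ 0ℚ
  fromℕ∣∣≢0 (true  ∷ p) _                 = fromℕ-suc≢0 ∣ p ∣
  fromℕ∣∣≢0 (false ∷ p) (suc x , there x∈p) = fromℕ∣∣≢0 p (x , x∈p)

  elements : ∀ {n} (p : Subset n) → Fin ∣ p ∣ → Fin n
  elements (true  ∷ p) zero    = zero
  elements (true  ∷ p) (suc t) = suc (elements p t)
  elements (false ∷ p) t       = suc (elements p t)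

  elements-∈ : ∀ {n} (p : Subset n) t → elements p t ∈ p
  elements-∈ (true  ∷ p) zero    = here
  elements-∈ (true  ∷ p) (suc t) = there (elements-∈ p t)
  elements-∈ (false ∷ p) t       = there (elements-∈ p t)

  elements-injective : ∀ {n} (p : Subset n) → Injective _≡_ _≡_ (elements p)
  elements-injective (true  ∷ p) {zero}  {zero}  _  = refl
  elements-injective (true  ∷ p) {suc t} {suc u} eq =
    cong suc (elements-injective p (suc-injective eq))
  elements-injective (false ∷ p) eq                 = elements-injective p (suc-injective eq)

  mulVec-combination : ∀ {n} (M : Fin n → Fin n → ℚ) a u b v i →
    mulVec M (λ j → a * u j - b * v j) i ≡ a * mulVec M u i - b * mulVec M v i
  mulVec-combination M a u b v i = begin
    sumFin (λ j → M i j * (a * u j - b * v j))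
      ≡⟨ sumFin-cong (λ j → distribute a b (M i j) (u j) (v j)) ⟩
    sumFin (λ j → a * (M i j * u j) - b * (M i j * v j))
      ≡⟨ sumFin-sub (λ j → a * (M i j * u j)) (λ j → b * (M i j * v j)) ⟩
    sumFin (λ j → a * (M i j * u j)) - sumFin (λ j → b * (M i j * v j))
      ≡⟨ cong₂ _-_ (sumFin-*ˡ a (λ j → M i j * u j)) (sumFin-*ˡ b (λ j → M i j * v j)) ⟩
    a * mulVec M u i - b * mulVec M v i ∎
    where
    distribute : ∀ a b m x y → m * (a * x - b * y) ≡ a * (m * x) - b * (m * y)
    distribute = solve-∀ ℚ-ring

  ifEq-≡ : ∀ {a b} x → a ≡ b → ifEq a b x ≡ x
  ifEq-≡ {a} x refl = cong (λ c → if c then x else 0) (Equivalence.to T-≡ (ℕ.≡⇒≡ᵇ a a refl))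

  ifEq-≢ : ∀ {a b} x → a ≢ b → ifEq a b x ≡ 0
  ifEq-≢ {a} {b} x a≢b =
    cong (λ c → if c then x else 0) (¬-not (a≢b ∘ ℕ.≡ᵇ⇒≡ a b ∘ Equivalence.from T-≡))

  ifEq-elim : ∀ {ℓ} (F : ℕ → Set ℓ) {a b x} → (a ≡ b → F x) → F 0 → F (ifEq a b x)
  ifEq-elim F {a} {b} {x} onEqual onDistinct with a ℕ.≟ b
  ... | yes a≡b = subst F (sym (ifEq-≡ x a≡b)) (onEqual a≡b)
  ... | no  a≢b = subst F (sym (ifEq-≢ x a≢b)) onDistinct

  sumFinℕ-zero : ∀ {c} (g : Fin c → ℕ) → (∀ k → g k ≡ 0) → sumFinℕ g ≡ 0
  sumFinℕ-zero {zero}  _ _   = refl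
  sumFinℕ-zero {suc c} g g≗0 = cong₂ ℕ._+_ (g≗0 zero) (sumFinℕ-zero (g ∘ suc) (g≗0 ∘ suc))

  -- The pivots make the family linearly independent; R bounds the supports, so that families
  -- over disjoint R can be joined.
  record EigenFamily {n} (M : Fin n → Fin n → ℚ) (λ' : ℚ) (R : Fin n → Set) (N : ℕ) : Set where
    field
      vec        : Fin N → Fin n → ℚ
      pivot      : Fin N → Fin n
      eigen      : ∀ t i → mulVec M (vec t) i ≡ λ' * vec t i
      supported  : ∀ t i → ¬ R i → vec t i ≡ 0ℚ
      pivot∈     : ∀ t → R (pivot t)
      pivot≢0    : ∀ t → vec t (pivot t) ≢ 0ℚ
      pivot-only : ∀ t t′ → t′ ≢ t → vec t′ (pivot t) ≡ 0ℚ

  module _ {n} {M : Fin n → Fin n → ℚ} {λ' : ℚ} where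

    EigenFamily⇒EigenMultAtLeast : ∀ {R N} → EigenFamily M λ' R N → EigenMultAtLeast M λ' N
    EigenFamily⇒EigenMultAtLeast F = vec , independent , eigen
      where
      open EigenFamily F
      independent : LinIndep vec
      independent c c·vec≡0 t = x*y≡0⇒x≡0 (pivot≢0 t) (begin
        c t * vec t (pivot t)                     ≡⟨ sumFin-single _ t others ⟨
        sumFin (λ t′ → c t′ * vec t′ (pivot t))   ≡⟨ c·vec≡0 (pivot t) ⟩
        0ℚ                                        ∎)
        where
        others : ∀ t′ → t′ ≢ t → c t′ * vec t′ (pivot t) ≡ 0ℚ
        others t′ t′≢t = trans (cong (c t′ *_) (pivot-only t t′ t′≢t)) (ℚ.*-zeroʳ (c t′))

    []ᴱ : ∀ {R} → EigenFamily M λ' R 0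
    []ᴱ = record
      { vec = λ () ; pivot = λ () ; eigen = λ () ; supported = λ ()
      ; pivot∈ = λ () ; pivot≢0 = λ () ; pivot-only = λ () }

    weakenᴱ : ∀ {R R′ N} → (∀ {i} → R i → R′ i) → EigenFamily M λ' R N → EigenFamily M λ' R′ N
    weakenᴱ R⊆R′ F = record
      { vec        = vec
      ; pivot      = pivot
      ; eigen      = eigen
      ; supported  = λ t i ¬R′i → supported t i (¬R′i ∘ R⊆R′)
      ; pivot∈     = R⊆R′ ∘ pivot∈
      ; pivot≢0    = pivot≢0
      ; pivot-only = pivot-only
      }
      where open EigenFamily F

    appendᴱ : ∀ {R₁ R₂ N₁ N₂} → (∀ {i} → R₁ i → R₂ i → ⊥) →
      EigenFamily M λ' R₁ N₁ → EigenFamily M λ' R₂ N₂ →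
      EigenFamily M λ' (λ i → R₁ i ⊎ R₂ i) (N₁ ℕ.+ N₂)
    appendᴱ {R₁} {R₂} {N₁} {N₂} disjoint F₁ F₂ = record
      { vec        = vec ∘ splitAt N₁
      ; pivot      = pivot ∘ splitAt N₁
      ; eigen      = eigen ∘ splitAt N₁
      ; supported  = supported ∘ splitAt N₁
      ; pivot∈     = pivot∈ ∘ splitAt N₁
      ; pivot≢0    = pivot≢0 ∘ splitAt N₁
      ; pivot-only = λ t t′ t′≢t →
                       pivot-only (splitAt N₁ t) (splitAt N₁ t′) (t′≢t ∘ splitAt-injective)
      }
      where
      module F₁ = EigenFamily F₁
      module F₂ = EigenFamily F₂
      Index : Set
      Index = Fin N₁ ⊎ Fin N₂

      splitAt-injective : ∀ {t t′} → splitAt N₁ t ≡ splitAt N₁ t′ → t ≡ t′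
      splitAt-injective {t} {t′} eq =
        trans (sym (join-splitAt N₁ N₂ t)) (trans (cong (join N₁ N₂) eq) (join-splitAt N₁ N₂ t′))

      vec : Index → Fin n → ℚ
      vec = [ F₁.vec , F₂.vec ]

      pivot : Index → Fin n
      pivot = [ F₁.pivot , F₂.pivot ]

      eigen : ∀ s i → mulVec M (vec s) i ≡ λ' * vec s i
      eigen (inj₁ t) = F₁.eigen t
      eigen (inj₂ t) = F₂.eigen t

      supported : ∀ s i → ¬ (R₁ i ⊎ R₂ i) → vec s i ≡ 0ℚ
      supported (inj₁ t) i ¬R = F₁.supported t i (¬R ∘ inj₁)
      supported (inj₂ t) i ¬R = F₂.supported t i (¬R ∘ inj₂)

      pivot∈ : ∀ s → R₁ (pivot s) ⊎ R₂ (pivot s)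
      pivot∈ (inj₁ t) = inj₁ (F₁.pivot∈ t)
      pivot∈ (inj₂ t) = inj₂ (F₂.pivot∈ t)

      pivot≢0 : ∀ s → vec s (pivot s) ≢ 0ℚ
      pivot≢0 (inj₁ t) = F₁.pivot≢0 t
      pivot≢0 (inj₂ t) = F₂.pivot≢0 t

      pivot-only : ∀ s s′ → s′ ≢ s → vec s′ (pivot s) ≡ 0ℚ
      pivot-only (inj₁ t) (inj₁ t′) t′≢t = F₁.pivot-only t t′ (t′≢t ∘ cong inj₁)
      pivot-only (inj₂ t) (inj₂ t′) t′≢t = F₂.pivot-only t t′ (t′≢t ∘ cong inj₂)
      pivot-only (inj₁ t) (inj₂ t′) _    = F₂.supported t′ _ (disjoint (F₁.pivot∈ t))
      pivot-only (inj₂ t) (inj₁ t′) _    = F₁.supported t′ _ (λ r₁ → disjoint r₁ (F₂.pivot∈ t))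

    concatᴱ : ∀ {c} {R : Fin c → Fin n → Set} {N : Fin c → ℕ} →
      (∀ {k k′ i} → R k i → R k′ i → k ≡ k′) → (∀ k → EigenFamily M λ' (R k) (N k)) →
      EigenFamily M λ' (λ i → ∃[ k ] R k i) (sumFinℕ N)
    concatᴱ {zero}  _        _        = []ᴱ
    concatᴱ {suc c} disjoint families =
      weakenᴱ [ (λ r → zero , r) , (λ (k , r) → suc k , r) ]
        (appendᴱ (λ r₀ (k , r) → 0≢1+n (disjoint r₀ r))
          (families zero)
          (concatᴱ (λ r r′ → suc-injective (disjoint r r′)) (families ∘ suc)))

  module _ {n : ℕ} (G : Graph n) where

    A : Fin n → Fin n → ℚ
    A i j = 𝟙 (adj G i j)

    fromℕ-degree : ∀ i → fromℕ (degree G i) ≡ sumFin (A i)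
    fromℕ-degree i = trans (sumFin-𝟙 (tabulate (adj G i)))
                           (sumFin-cong (cong 𝟙 ∘ lookup∘tabulate (adj G i)))

    laplacian-entry : ∀ i j → laplacian G i j ≡ δ i j * fromℕ (degree G i) - A i j
    laplacian-entry i j with i ≟ j
    ... | yes refl rewrite irrefl G i = sym (unit (fromℕ (degree G i)))
      where
      unit : ∀ d → 1ℚ * d - 0ℚ ≡ d
      unit = solve-∀ ℚ-ring
    ... | no _ with adj G i j
    ...   | true  = sym (cong (_- 1ℚ) (ℚ.*-zeroˡ (fromℕ (degree G i))))
    ...   | false = sym (cong (_- 0ℚ) (ℚ.*-zeroˡ (fromℕ (degree G i))))

    laplacian-mulVec : ∀ x i → mulVec (laplacian G) x i ≡ sumFin (λ j → A i j * (x i - x j))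
    laplacian-mulVec x i = begin
      sumFin (λ j → laplacian G i j * x j)
        ≡⟨ sumFin-cong (λ j → trans (cong (_* x j) (laplacian-entry i j))
                                   (expand (δ i j) d (A i j) (x j))) ⟩
      sumFin (λ j → δ i j * (d * x j) - A i j * x j)
        ≡⟨ sumFin-sub (λ j → δ i j * (d * x j)) (λ j → A i j * x j) ⟩
      sumFin (λ j → δ i j * (d * x j)) - sumFin (λ j → A i j * x j)
        ≡⟨ cong (_- sumFin (λ j → A i j * x j)) (sumFin-δ i (λ j → d * x j)) ⟩
      d * x i - sumFin (λ j → A i j * x j)
        ≡⟨ cong (λ e → e * x i - sumFin (λ j → A i j * x j)) (fromℕ-degree i) ⟩
      sumFin (A i) * x i - sumFin (λ j → A i j * x j)
        ≡⟨ cong (_- sumFin (λ j → A i j * x j)) (sumFin-*ʳ (x i) (A i)) ⟨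
      sumFin (λ j → A i j * x i) - sumFin (λ j → A i j * x j)
        ≡⟨ sumFin-sub (λ j → A i j * x i) (λ j → A i j * x j) ⟨
      sumFin (λ j → A i j * x i - A i j * x j)
        ≡⟨ sumFin-cong (λ j → factor (A i j) (x i) (x j)) ⟩
      sumFin (λ j → A i j * (x i - x j)) ∎
      where
      d : ℚ
      d = fromℕ (degree G i)
      expand : ∀ e d a y → (e * d - a) * y ≡ e * (d * y) - a * y
      expand = solve-∀ ℚ-ring
      factor : ∀ a u v → a * u - a * v ≡ a * (u - v)
      factor = solve-∀ ℚ-ring

    SupportedOnSimplicial : Subset n → (Fin n → ℚ) → Set
    SupportedOnSimplicial Q x = ∀ j → x j ≢ 0ℚ → j ∈ Q × Simplicial G j

    module _ {Q : Subset n} (Q-max : IsMaxClique G Q)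
             {x : Fin n → ℚ} (x-supported : SupportedOnSimplicial Q x) where

      A-on-support : ∀ i j → j ≢ i → A i j * x i ≡ 𝟙 (lookup Q j) * x i
      A-on-support i j j≢i with x i ℚ.≟ 0ℚ
      ... | yes xi≡0 rewrite xi≡0 = trans (ℚ.*-zeroʳ (A i j)) (sym (ℚ.*-zeroʳ (𝟙 (lookup Q j))))
      ... | no  xi≢0 with x-supported i xi≢0
      ...   | i∈Q , i-simp = cong (λ b → 𝟙 b * x i) (true⇔true⇒≡
              (⇔-trans (simplicial-adj⇔∈ G Q-max i∈Q i-simp j≢i) (↔⇒⇔ []=↔lookup)))

      laplacian-on-support : ∀ i →
        mulVec (laplacian G) x i ≡ fromℕ ∣ Q ∣ * x i - 𝟙 (lookup Q i) * sumFin x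
      laplacian-on-support i = begin
        mulVec (laplacian G) x i
          ≡⟨ laplacian-mulVec x i ⟩
        sumFin (λ j → A i j * (x i - x j))
          ≡⟨ sumFin-cong term ⟩
        sumFin (λ j → 𝟙 (lookup Q j) * x i - 𝟙 (lookup Q i) * x j)
          ≡⟨ sumFin-sub (λ j → 𝟙 (lookup Q j) * x i) (λ j → 𝟙 (lookup Q i) * x j) ⟩
        sumFin (λ j → 𝟙 (lookup Q j) * x i) - sumFin (λ j → 𝟙 (lookup Q i) * x j)
          ≡⟨ cong₂ _-_ (sumFin-*ʳ (x i) (λ j → 𝟙 (lookup Q j))) (sumFin-*ˡ (𝟙 (lookup Q i)) x) ⟩
        sumFin (λ j → 𝟙 (lookup Q j)) * x i - 𝟙 (lookup Q i) * sumFin x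
          ≡⟨ cong (λ c → c * x i - 𝟙 (lookup Q i) * sumFin x) (sumFin-𝟙 Q) ⟨
        fromℕ ∣ Q ∣ * x i - 𝟙 (lookup Q i) * sumFin x ∎
        where
        vanish : ∀ c u → 0ℚ * (u - u) ≡ c * u - c * u
        vanish = solve-∀ ℚ-ring
        distribute : ∀ a u v → a * (u - v) ≡ a * u - a * v
        distribute = solve-∀ ℚ-ring
        term : ∀ j → A i j * (x i - x j) ≡ 𝟙 (lookup Q j) * x i - 𝟙 (lookup Q i) * x j
        term j with j ≟ i
        ... | yes refl rewrite irrefl G i = vanish (𝟙 (lookup Q i)) (x i)
        ... | no  j≢i = trans (distribute (A i j) (x i) (x j)) (cong₂ _-_ (A-on-support i j j≢i)
              (trans (cong (λ b → 𝟙 b * x j) (Graph.sym G i j)) (A-on-support j i (j≢i ∘ sym))))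

    twin : Fin n → Fin n → Fin n → ℚ
    twin p q j = δ p j - δ q j

    twin-away : ∀ p q {j} → p ≢ j → q ≢ j → twin p q j ≡ 0ℚ
    twin-away p q p≢j q≢j = cong₂ _-_ (δ-≢ p≢j) (δ-≢ q≢j)

    twin-pivot≢0 : ∀ {p q} → q ≢ p → twin p q p ≢ 0ℚ
    twin-pivot≢0 {p} q≢p twin≡0 with trans (sym (cong₂ _-_ (δ-refl p) (δ-≢ q≢p))) twin≡0
    ... | ()

    twin-eigen : ∀ {Q p q} → IsMaxClique G Q → p ∈ Q → Simplicial G p → q ∈ Q → Simplicial G q →
      ∀ i → mulVec (laplacian G) (twin p q) i ≡ fromℕ ∣ Q ∣ * twin p q i
    twin-eigen {Q} {p} {q} Q-max p∈Q p-simp q∈Q q-simp i = begin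
      mulVec (laplacian G) (twin p q) i
        ≡⟨ laplacian-on-support Q-max supported i ⟩
      fromℕ ∣ Q ∣ * twin p q i - 𝟙 (lookup Q i) * sumFin (twin p q)
        ≡⟨ cong (λ σ → fromℕ ∣ Q ∣ * twin p q i - 𝟙 (lookup Q i) * σ) sum≡0 ⟩
      fromℕ ∣ Q ∣ * twin p q i - 𝟙 (lookup Q i) * 0ℚ
        ≡⟨ drop (fromℕ ∣ Q ∣ * twin p q i) (𝟙 (lookup Q i)) ⟩
      fromℕ ∣ Q ∣ * twin p q i ∎
      where
      drop : ∀ a c → a - c * 0ℚ ≡ a
      drop = solve-∀ ℚ-ring
      sum≡0 : sumFin (twin p q) ≡ 0ℚ
      sum≡0 = trans (sumFin-sub (δ p) (δ q)) (cong₂ _-_ (sumFin-δ₁ p) (sumFin-δ₁ q))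
      supported : SupportedOnSimplicial Q (twin p q)
      supported j twin≢0 with j ≟ p | j ≟ q
      ... | yes refl | _        = p∈Q , p-simp
      ... | no  _    | yes refl = q∈Q , q-simp
      ... | no  j≢p  | no  j≢q  = ⊥-elim (twin≢0 (twin-away p q (j≢p ∘ sym) (j≢q ∘ sym)))

    twinFamily : ∀ {Q P} → IsMaxClique G Q → (∀ {j} → j ∈ P → j ∈ Q × Simplicial G j) →
      EigenFamily (laplacian G) (fromℕ ∣ Q ∣) (_∈ P) (∣ P ∣ ∸ 1)
    twinFamily {Q} {P} Q-max P-simplicial =
      family ∣ P ∣ (elements P) (elements-injective P) (elements-∈ P)
      where
      family : ∀ r (el : Fin r → Fin n) → Injective _≡_ _≡_ el → (∀ t → el t ∈ P) →
        EigenFamily (laplacian G) (fromℕ ∣ Q ∣) (_∈ P) (r ∸ 1)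
      family zero    _  _      _    = []ᴱ
      family (suc r) el el-inj el∈P = record
        { vec        = λ t → twin (el (suc t)) (el zero)
        ; pivot      = λ t → el (suc t)
        ; eigen      = λ t → twin-eigen Q-max (proj₁ (in-P (suc t))) (proj₂ (in-P (suc t)))
                                              (proj₁ (in-P zero)) (proj₂ (in-P zero))
        ; supported  = λ t i i∉P → twin-away (el (suc t)) (el zero) {i}
                         (λ { refl → i∉P (el∈P (suc t)) }) (λ { refl → i∉P (el∈P zero) })
        ; pivot∈     = λ t → el∈P (suc t)
        ; pivot≢0    = λ t → twin-pivot≢0 (distinct t ∘ sym)
        ; pivot-only = λ t t′ t′≢t → twin-away (el (suc t′)) (el zero)
                                       (t′≢t ∘ suc-injective ∘ el-inj) (distinct t ∘ sym)
        }
        where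
        in-P : ∀ t → el t ∈ Q × Simplicial G (el t)
        in-P t = P-simplicial (el∈P t)
        distinct : ∀ t → el (suc t) ≢ el zero
        distinct t eq with el-inj eq
        ... | ()

  separatorVector : ∀ {n} → Subset n → Subset n → Fin n → ℚ
  separatorVector P₀ P₁ j = fromℕ ∣ P₁ ∣ * 𝟙 (lookup P₀ j) - fromℕ ∣ P₀ ∣ * 𝟙 (lookup P₁ j)

  module _ {n} {G : Graph n} {S : Subset n}
           (S-nonsimplicial : ∀ {s} → s ∈ S → ¬ Simplicial G s) where

    module _ {Q P : Subset n} (split : SimplicialSplit G S Q P) where
      open SimplicialSplit split

      split-𝟙 : ∀ j → 𝟙 (lookup Q j) ≡ 𝟙 (lookup S j) + 𝟙 (lookup P j)
      split-𝟙 j with j ∈? S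
      ... | yes j∈S = trans (𝟙-∈ (S⊆Q j∈S))
                            (sym (cong₂ _+_ (𝟙-∈ j∈S) (𝟙-∉ (S-nonsimplicial j∈S ∘ P-simplicial))))
      ... | no  j∉S with j ∈? P
      ...   | yes j∈P = trans (𝟙-∈ (P⊆Q j∈P)) (sym (cong₂ _+_ (𝟙-∉ j∉S) (𝟙-∈ j∈P)))
      ...   | no  j∉P = trans (𝟙-∉ (λ j∈Q → j∉S (Q∖P⊆S j∈Q j∉P)))
                              (sym (cong₂ _+_ (𝟙-∉ j∉S) (𝟙-∉ j∉P)))

      split-card : fromℕ ∣ Q ∣ ≡ fromℕ ∣ S ∣ + fromℕ ∣ P ∣
      split-card = begin
        fromℕ ∣ Q ∣
          ≡⟨ sumFin-𝟙 Q ⟩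
        sumFin (λ j → 𝟙 (lookup Q j))
          ≡⟨ sumFin-cong split-𝟙 ⟩
        sumFin (λ j → 𝟙 (lookup S j) + 𝟙 (lookup P j))
          ≡⟨ sumFin-+ (λ j → 𝟙 (lookup S j)) (λ j → 𝟙 (lookup P j)) ⟩
        sumFin (λ j → 𝟙 (lookup S j)) + sumFin (λ j → 𝟙 (lookup P j))
          ≡⟨ cong₂ _+_ (sumFin-𝟙 S) (sumFin-𝟙 P) ⟨
        fromℕ ∣ S ∣ + fromℕ ∣ P ∣ ∎

      indicator-eigen : ∀ i → mulVec (laplacian G) (λ j → 𝟙 (lookup P j)) i
                              ≡ fromℕ ∣ Q ∣ * 𝟙 (lookup P i) - 𝟙 (lookup Q i) * fromℕ ∣ P ∣
      indicator-eigen i =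
        trans (laplacian-on-support G maxClique supported i)
              (cong (λ σ → fromℕ ∣ Q ∣ * 𝟙 (lookup P i) - 𝟙 (lookup Q i) * σ) (sym (sumFin-𝟙 P)))
        where
        supported : SupportedOnSimplicial G Q (λ j → 𝟙 (lookup P j))
        supported j 𝟙≢0 = Equivalence.to (simplicial j) (𝟙≢0⇒∈ 𝟙≢0)

    separatorVector-eigen : ∀ {Q₀ P₀ Q₁ P₁} →
      SimplicialSplit G S Q₀ P₀ → SimplicialSplit G S Q₁ P₁ →
      ∀ i → mulVec (laplacian G) (separatorVector P₀ P₁) i ≡ fromℕ ∣ S ∣ * separatorVector P₀ P₁ i
    separatorVector-eigen {Q₀} {P₀} {Q₁} {P₁} split₀ split₁ i = begin
      mulVec (laplacian G) (separatorVector P₀ P₁) i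
        ≡⟨ mulVec-combination (laplacian G) a (λ j → 𝟙 (lookup P₀ j)) b (λ j → 𝟙 (lookup P₁ j)) i ⟩
      a * mulVec (laplacian G) (λ j → 𝟙 (lookup P₀ j)) i
        - b * mulVec (laplacian G) (λ j → 𝟙 (lookup P₁ j)) i
        ≡⟨ cong₂ (λ y z → a * y - b * z) (indicator-eigen split₀ i) (indicator-eigen split₁ i) ⟩
      a * (fromℕ ∣ Q₀ ∣ * u - 𝟙 (lookup Q₀ i) * b) - b * (fromℕ ∣ Q₁ ∣ * v - 𝟙 (lookup Q₁ i) * a)
        ≡⟨ cong₂ (λ y z → a * y - b * z)
                 (cong₂ (λ c t → c * u - t * b) (split-card split₀) (split-𝟙 split₀ i))
                 (cong₂ (λ c t → c * v - t * a) (split-card split₁) (split-𝟙 split₁ i)) ⟩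
      a * ((s + b) * u - (σ + u) * b) - b * ((s + a) * v - (σ + v) * a)
        ≡⟨ cancel a b s u v σ ⟩
      s * (a * u - b * v) ∎
      where
      a b s u v σ : ℚ
      a = fromℕ ∣ P₁ ∣
      b = fromℕ ∣ P₀ ∣
      s = fromℕ ∣ S ∣
      u = 𝟙 (lookup P₀ i)
      v = 𝟙 (lookup P₁ i)
      σ = 𝟙 (lookup S i)
      cancel : ∀ a b s u v σ → a * ((s + b) * u - (σ + u) * b) - b * ((s + a) * v - (σ + v) * a)
                               ≡ s * (a * u - b * v)
      cancel = solve-∀ ℚ-ring

  module _ {n} (G : Graph n) (S : Subset n) (S-nonsimplicial : ∀ {s} → s ∈ S → ¬ Simplicial G s)
           {b} (Q P : Fin (suc (suc b)) → Subset n) (Q-injective : Injective _≡_ _≡_ Q)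
           (split : ∀ k → SimplicialSplit G S (Q k) (P k)) where

    module Split k = SimplicialSplit (split k)

    P∩Q⇒≡ : ∀ {k k′ j} → j ∈ P k → j ∈ Q k′ → k ≡ k′
    P∩Q⇒≡ {k} {k′} j∈Pk j∈Qk′ = Q-injective (simplicial-unique-maxClique G
      (Split.maxClique k) (Split.maxClique k′) (Split.P⊆Q k j∈Pk) j∈Qk′ (Split.P-simplicial k j∈Pk))

    ∣S∣<∣Q∣ : ∀ k → ∣ S ∣ < ∣ Q k ∣
    ∣S∣<∣Q∣ k with Split.P-nonempty k
    ... | p , p∈P = p⊂q⇒∣p∣<∣q∣ (Split.S⊆Q k , p , Split.P⊆Q k p∈P , p∉S)
      where
      p∉S : p ∉ S
      p∉S p∈S = S-nonsimplicial p∈S (Split.P-simplicial k p∈P)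

    cliqueFamily : ∀ μ k →
      EigenFamily (laplacian G) (fromℕ μ) (_∈ P k) (ifEq ∣ Q k ∣ μ (∣ P k ∣ ∸ 1))
    cliqueFamily μ k = ifEq-elim (EigenFamily (laplacian G) (fromℕ μ) (_∈ P k)) {∣ Q k ∣} {μ}
      (λ ∣Q∣≡μ → subst (λ c → EigenFamily (laplacian G) (fromℕ c) (_∈ P k) (∣ P k ∣ ∸ 1)) ∣Q∣≡μ
                   (twinFamily G (Split.maxClique k) (Equivalence.to (Split.simplicial k _))))
      []ᴱ

    separatorFamily : EigenFamily (laplacian G) (fromℕ ∣ S ∣) (λ _ → ⊤) (suc b)
    separatorFamily = record
      { vec        = λ t → separatorVector (P zero) (P (suc t))
      ; pivot      = λ t → pivotOf (suc t)
      ; eigen      = λ t → separatorVector-eigen S-nonsimplicial (split zero) (split (suc t))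
      ; supported  = λ _ _ ¬⊤ → ⊥-elim (¬⊤ tt)
      ; pivot∈     = λ _ → tt
      ; pivot≢0    = at-pivot≢0
      ; pivot-only = off-pivot
      }
      where
      pivotOf : ∀ k → Fin n
      pivotOf k = proj₁ (Split.P-nonempty k)
      𝟙-pivotOf : ∀ {k k′} → k′ ≢ k → 𝟙 (lookup (P k′) (pivotOf k)) ≡ 0ℚ
      𝟙-pivotOf {k} k′≢k =
        𝟙-∉ (λ p∈Pk′ → k′≢k (P∩Q⇒≡ p∈Pk′ (Split.P⊆Q k (proj₂ (Split.P-nonempty k)))))
      zeros : ∀ x y → x * 0ℚ - y * 0ℚ ≡ 0ℚ
      zeros = solve-∀ ℚ-ring
      negated : ∀ x y → x * 0ℚ - y * 1ℚ ≡ - y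
      negated = solve-∀ ℚ-ring
      off-pivot : ∀ t t′ → t′ ≢ t → separatorVector (P zero) (P (suc t′)) (pivotOf (suc t)) ≡ 0ℚ
      off-pivot t t′ t′≢t = trans
        (cong₂ (λ x y → fromℕ ∣ P (suc t′) ∣ * x - fromℕ ∣ P zero ∣ * y)
               (𝟙-pivotOf 0≢1+n) (𝟙-pivotOf (t′≢t ∘ suc-injective)))
        (zeros (fromℕ ∣ P (suc t′) ∣) (fromℕ ∣ P zero ∣))
      at-pivot≢0 : ∀ t → separatorVector (P zero) (P (suc t)) (pivotOf (suc t)) ≢ 0ℚ
      at-pivot≢0 t vec≡0 = fromℕ∣∣≢0 (P zero) (Split.P-nonempty zero) (ℚ.neg-injective (begin
        - fromℕ ∣ P zero ∣
          ≡⟨ negated (fromℕ ∣ P (suc t) ∣) (fromℕ ∣ P zero ∣) ⟨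
        fromℕ ∣ P (suc t) ∣ * 0ℚ - fromℕ ∣ P zero ∣ * 1ℚ
          ≡⟨ cong₂ (λ x y → fromℕ ∣ P (suc t) ∣ * x - fromℕ ∣ P zero ∣ * y)
                   (𝟙-pivotOf 0≢1+n) (𝟙-∈ (proj₂ (Split.P-nonempty (suc t)))) ⟨
        separatorVector (P zero) (P (suc t)) (pivotOf (suc t))
          ≡⟨ vec≡0 ⟩
        0ℚ ∎))

    splitCliques-spectrum : ∀ μ → EigenMultAtLeast (laplacian G) (fromℕ μ)
      (sumFinℕ (λ k → ifEq ∣ Q k ∣ μ (∣ P k ∣ ∸ 1)) ℕ.+ ifEq ∣ S ∣ μ (suc b))
    splitCliques-spectrum μ with ∣ S ∣ ℕ.≟ μ
    ... | yes refl = subst (EigenMultAtLeast (laplacian G) (fromℕ ∣ S ∣)) (sym separatorOnly)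
                       (EigenFamily⇒EigenMultAtLeast separatorFamily)
      where
      separatorOnly :
        sumFinℕ (λ k → ifEq ∣ Q k ∣ ∣ S ∣ (∣ P k ∣ ∸ 1)) ℕ.+ ifEq ∣ S ∣ ∣ S ∣ (suc b) ≡ suc b
      separatorOnly = cong₂ ℕ._+_
        (sumFinℕ-zero _ (λ k → ifEq-≢ (∣ P k ∣ ∸ 1) (ℕ.<⇒≢ (∣S∣<∣Q∣ k) ∘ sym)))
        (ifEq-≡ {∣ S ∣} (suc b) refl)
    ... | no ∣S∣≢μ = subst (EigenMultAtLeast (laplacian G) (fromℕ μ)) (sym cliquesOnly)
                       (EigenFamily⇒EigenMultAtLeast (concatᴱ P-disjoint (cliqueFamily μ)))
      where
      P-disjoint : ∀ {k k′ j} → j ∈ P k → j ∈ P k′ → k ≡ k′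
      P-disjoint {k′ = k′} j∈Pk j∈Pk′ = P∩Q⇒≡ j∈Pk (Split.P⊆Q k′ j∈Pk′)
      cliquesOnly : sumFinℕ (λ k → ifEq ∣ Q k ∣ μ (∣ P k ∣ ∸ 1)) ℕ.+ ifEq ∣ S ∣ μ (suc b)
                    ≡ sumFinℕ (λ k → ifEq ∣ Q k ∣ μ (∣ P k ∣ ∸ 1))
      cliquesOnly = trans (cong (_ ℕ.+_) (ifEq-≢ (suc b) ∣S∣≢μ)) (ℕ.+-identityʳ _)

open import Data.Integer using (+_)
open import Data.Nat using (_+_)
open import Data.Rational using (_/_)
open import Function.Definitions using (Injective)
open LaplacianEigenvectors using (splitCliques-spectrum)

corollary1 : ∀ {n} (G : Graph n) → Connected G → IsStrictlyChordal G →
    (S : Subset n) → IsMinimalVertexSeparator G S →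
    (b : ℕ) → 1 < b → (Q : Fin b → Subset n) → Injective _≡_ _≡_ Q →
    (∀ k → BoundaryClique G (Q k) × S ⊆ Q k) →
    (∀ Q' → BoundaryClique G Q' → S ⊆ Q' → ∃[ k ] Q k ≡ Q') →
    (P : Fin b → Subset n) →
    (∀ k v → (v ∈ P k) ⇔ (v ∈ Q k × Simplicial G v)) →
    ∀ (μ : ℕ) → EigenMultAtLeast (laplacian G) ((+ μ) / 1)
      (sumFinℕ (λ k → ifEq ∣ Q k ∣ μ (∣ P k ∣ ∸ 1)) + ifEq ∣ S ∣ μ (b ∸ 1))
-- The lower bound does not need that Q lists all of B(S).
corollary1 G connected (_ , H , f , blockGraph , _ , expansion) S (_ , _ , _ , _ , minSep)
           (suc (suc b)) (ℕ.s≤s (ℕ.s≤s ℕ.z≤n)) Q Q-injective boundary _ P P⇔ =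
  splitCliques-spectrum G S S-nonsimplicial Q P Q-injective split
  where
  Q-max : ∀ k → IsMaxClique G (Q k)
  Q-max k = proj₁ (proj₁ (proj₁ (boundary k)))
  S-nonsimplicial : ∀ {s} → s ∈ S → ¬ Simplicial G s
  S-nonsimplicial s∈S = maxCliques-∩⇒nonsimplicial G (Q-max zero) (Q-max (suc zero))
    (0≢1+n ∘ Q-injective) (proj₂ (boundary zero) s∈S) (proj₂ (boundary (suc zero)) s∈S)
  split : ∀ k → SimplicialSplit G S (Q k) (P k)
  split k = boundaryClique-split blockGraph expansion connected minSep S-nonsimplicial
              (proj₁ (boundary k)) (proj₂ (boundary k)) (P⇔ k)
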